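{- Let $p$ be a prime, $M=M[A]$ a simple, coloopless, connected $p$-matroid on ground set $E$, $a,b\in E$ distinct, $\alpha\in GF(p)$ nonzero, $e\in\{a,b\}$. Then the $es$-splitting matroid $M^e_{a,b}$ is connected.
   Context: A $p$-matroid is a matroid representable over $GF(p)$, $A$ a representing matrix over $GF(p)$ with columns indexed by $E$. $A'_{a,b}$ is obtained from $A$ by appending a last row with $\alpha$ in columns $a,b$ and $0$ elsewhere, then a column $z$ with last coordinate $\alpha$ and $0$ elsewhere. $A^e_{a,b}$ is obtained from $A'_{a,b}$ by appending a column $\gamma$ = (column of $e$) $-$ (column $z$); $M^e_{a,b}$ is the vector matroid of $A^e_{a,b}$ on $E\cup\{z,\gamma\}$. -}

module Defs where

open import Data.Nat using (ℕ; zero; suc; _+_; _*_; _∸_; _<_; NonZero)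
open import Data.Nat.DivMod using (_mod_)
open import Data.Fin using (Fin; toℕ; splitAt; _≟_; _↑ˡ_; _↑ʳ_)
open import Data.Fin as Fin using ()
open import Data.Fin.Subset using (Subset; _∈_; _⊂_; ∣_∣)
open import Data.Sum using (_⊎_; inj₁; inj₂)
open import Data.Product using (Σ; ∃; _×_)
open import Relation.Nullary using (¬_; yes; no)
open import Relation.Binary.PropositionalEquality using (_≡_; _≢_)

module GF (p : ℕ) .{{_ : NonZero p}} where

  F : Set
  F = Fin p

  0F : F
  0F = 0 mod p

  _+F_ : F → F → F
  x +F y = (toℕ x + toℕ y) mod p

  _*F_ : F → F → F
  x *F y = (toℕ x * toℕ y) mod p

  _-F_ : F → F → F
  x -F y = (toℕ x + (p ∸ toℕ y)) mod p

  ΣF : {k : ℕ} → (Fin k → F) → F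
  ΣF {zero}  f = 0F
  ΣF {suc k} f = f Fin.zero +F ΣF (λ j → f (Fin.suc j))

  -- an m × k matrix over GF(p); columns indexed by Fin k (the ground set)
  Mat : ℕ → ℕ → Set
  Mat m k = Fin m → Fin k → F

  Dependent : {m k : ℕ} → Mat m k → Subset k → Set
  Dependent {m} {k} A S =
    Σ (Fin k → F) λ c →
      (∀ j → c j ≢ 0F → j ∈ S) ×
      (∃ λ j → c j ≢ 0F) ×
      (∀ i → ΣF (λ j → c j *F A i j) ≡ 0F)

  Circuit : {m k : ℕ} → Mat m k → Subset k → Set
  Circuit A C = Dependent A C × (∀ T → T ⊂ C → ¬ Dependent A T)

  -- simple: no loops and no parallel pairs, i.e. every circuit has ≥ 3 elements
  Simple : {m k : ℕ} → Mat m k → Set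
  Simple {k = k} A = ∀ (C : Subset k) → Circuit A C → 2 < ∣ C ∣

  Coloopless : {m k : ℕ} → Mat m k → Set
  Coloopless {k = k} A = ∀ (x : Fin k) → ∃ λ (C : Subset k) → Circuit A C × x ∈ C

  Connected : {m k : ℕ} → Mat m k → Set
  Connected {k = k} A =
    ∀ (x y : Fin k) → x ≢ y →
      ∃ λ (C : Subset k) → Circuit A C × x ∈ C × y ∈ C

  -- A'_{a,b}: rows Fin (m + 1) (new last row), columns Fin (k + 1) (new last column z)
  A′ : {m k : ℕ} → Mat m k → Fin k → Fin k → F → Mat (m + 1) (k + 1)
  A′ {m} {k} A a b α r c with splitAt m r | splitAt k c
  ... | inj₁ i | inj₁ j = A i j
  ... | inj₁ i | inj₂ _ = 0F
  ... | inj₂ _ | inj₂ _ = α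
  ... | inj₂ _ | inj₁ j with j ≟ a | j ≟ b
  ...   | yes _ | _     = α
  ...   | no _  | yes _ = α
  ...   | no _  | no _  = 0F

  zcol : {k : ℕ} → Fin (k + 1)
  zcol {k} = k ↑ʳ Fin.zero

  embE : {k : ℕ} → Fin k → Fin (k + 1)
  embE x = x ↑ˡ 1

  -- A^e_{a,b}: columns Fin ((k + 1) + 1); E = first k columns, then z, then γ,
  -- where γ = (column of e) − (column z) in A'_{a,b}
  Ae : {m k : ℕ} → Mat m k → Fin k → Fin k → F → Fin k → Mat (m + 1) ((k + 1) + 1)
  Ae {m} {k} A a b α e r c with splitAt (k + 1) c
  ... | inj₁ c′ = A′ A a b α r c′
  ... | inj₂ _  = A′ A a b α r (embE e) -F A′ A a b α r zcol

-- A vector t on the columns of B = A^e_{a,b} lies in its kernel iff its collapse (the coefficients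
-- on E, with the coefficient of γ added to that of e) lies in the kernel of A and t a + t b + t z = 0.
-- Hence a circuit C of A with circuit vector c lifts to circuits of B: ι C, together with z unless
-- c a + c b = 0, and, if e ∈ C, ι (C - e) ∪ {γ}, together with z unless the same sum without e
-- vanishes.  Minimality holds because a kernel vector of B inside such a support collapses to a
-- multiple of c.  As c e ≠ 0, one of the two lifts contains z; with the triangle {e, z, γ} (A has no
-- loops) this puts any two columns of B on a common circuit.

module Submission where

open import Defs
open import Level using (0ℓ)
open import Algebra.Bundles using (CommutativeRing)
open import Algebra.Structures using (IsCommutativeRing)
open import Data.Fin as Fin using (Fin; toℕ; splitAt; _↑ˡ_; _↑ʳ_; _≟_)
open import Data.Fin.Properties using (toℕ-fromℕ<; toℕ-injective; toℕ<n; punchInᵢ≢i; splitAt-↑ˡ; splitAt-↑ʳ; splitAt⁻¹-↑ˡ; splitAt⁻¹-↑ʳ)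
open import Data.Nat as ℕ using (ℕ; zero; suc; NonZero; _%_; _∸_)
import Data.Nat.Properties as ℕ
open import Data.Nat.DivMod using (_mod_; %-distribˡ-+; %-distribˡ-*; m<n⇒m%n≡m; n%n≡0)
open import Data.Nat.Divisibility using (_∣_; m%n≡0⇒n∣m; n∣m⇒m%n≡0)
open import Data.Nat.Primality using (Prime; euclidsLemma; prime⇒nonTrivial)
open import Data.Product using (_,_; ∃; ∃₂; _×_; proj₁; proj₂)
open import Data.Vec.Functional using (removeAt)
open import Data.Sum as Sum using (_⊎_; inj₁; inj₂; [_,_]′)
open import Data.Fin.Subset using (Subset; _∈_; _∉_; _⊂_; ⁅_⁆)
open import Data.Fin.Subset.Properties using (x∈⁅x⁆; x∈⁅y⁆⇒x≡y; ∣⁅x⁆∣≡1)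
open import Data.Vec using (tabulate)
open import Data.Vec.Properties using (lookup∘tabulate; lookup⇒[]=; []=⇒lookup)
open import Relation.Nullary using (¬_; Dec; yes; no; does; ¬?; contradiction)
open import Relation.Nullary.Decidable using (dec-true; dec-false)
open import Relation.Binary.PropositionalEquality using (subst; _≡_; _≢_; refl; sym; trans; cong; cong₂; isEquivalence; module ≡-Reasoning)

module GF-Ring (p : ℕ) .{{_ : NonZero p}} where
  open GF p

  [_] : ℕ → F
  [ n ] = n mod p

  toℕ-[] : ∀ n → toℕ [ n ] ≡ n % p
  toℕ-[] n = toℕ-fromℕ< _

  []-cong-% : ∀ {m n} → m % p ≡ n % p → [ m ] ≡ [ n ]
  []-cong-% eq = toℕ-injective (trans (toℕ-[] _) (trans eq (sym (toℕ-[] _))))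

  []-toℕ : ∀ x → [ toℕ x ] ≡ x
  []-toℕ x = toℕ-injective (trans (toℕ-[] _) (m<n⇒m%n≡m (toℕ<n x)))

  0%p≡0 : 0 % p ≡ 0
  0%p≡0 = m<n⇒m%n≡m (ℕ.>-nonZero⁻¹ p)

  toℕ-0F : toℕ 0F ≡ 0
  toℕ-0F = trans (toℕ-[] 0) 0%p≡0

  -- the ring laws of F are transported from ℕ along the reduction map [_]
  []-+ : ∀ m n → [ m ] +F [ n ] ≡ [ m ℕ.+ n ]
  []-+ m n = []-cong-% (trans (cong₂ (λ u v → (u ℕ.+ v) % p) (toℕ-[] m) (toℕ-[] n))
                              (sym (%-distribˡ-+ m n p)))

  []-* : ∀ m n → [ m ] *F [ n ] ≡ [ m ℕ.* n ]
  []-* m n = []-cong-% (trans (cong₂ (λ u v → (u ℕ.* v) % p) (toℕ-[] m) (toℕ-[] n))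
                              (sym (%-distribˡ-* m n p)))

  []-+ˡ : ∀ m y → [ m ] +F y ≡ [ m ℕ.+ toℕ y ]
  []-+ˡ m y = trans (cong ([ m ] +F_) (sym ([]-toℕ y))) ([]-+ m (toℕ y))

  []-+ʳ : ∀ x n → x +F [ n ] ≡ [ toℕ x ℕ.+ n ]
  []-+ʳ x n = trans (cong (_+F [ n ]) (sym ([]-toℕ x))) ([]-+ (toℕ x) n)

  []-*ˡ : ∀ m y → [ m ] *F y ≡ [ m ℕ.* toℕ y ]
  []-*ˡ m y = trans (cong ([ m ] *F_) (sym ([]-toℕ y))) ([]-* m (toℕ y))

  []-*ʳ : ∀ x n → x *F [ n ] ≡ [ toℕ x ℕ.* n ]
  []-*ʳ x n = trans (cong (_*F [ n ]) (sym ([]-toℕ x))) ([]-* (toℕ x) n)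

  negF : F → F
  negF x = [ p ∸ toℕ x ]

  1F : F
  1F = [ 1 ]

  -F≡+negF : ∀ x y → x -F y ≡ x +F negF y
  -F≡+negF x y = sym ([]-+ʳ x (p ∸ toℕ y))

  +F-assoc : ∀ x y z → (x +F y) +F z ≡ x +F (y +F z)
  +F-assoc x y z = trans ([]-+ˡ (toℕ x ℕ.+ toℕ y) z)
    (trans (cong [_] (ℕ.+-assoc (toℕ x) (toℕ y) (toℕ z))) (sym ([]-+ʳ x (toℕ y ℕ.+ toℕ z))))

  *F-assoc : ∀ x y z → (x *F y) *F z ≡ x *F (y *F z)
  *F-assoc x y z = trans ([]-*ˡ (toℕ x ℕ.* toℕ y) z)
    (trans (cong [_] (ℕ.*-assoc (toℕ x) (toℕ y) (toℕ z))) (sym ([]-*ʳ x (toℕ y ℕ.* toℕ z))))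

  +F-comm : ∀ x y → x +F y ≡ y +F x
  +F-comm x y = cong [_] (ℕ.+-comm (toℕ x) (toℕ y))

  *F-comm : ∀ x y → x *F y ≡ y *F x
  *F-comm x y = cong [_] (ℕ.*-comm (toℕ x) (toℕ y))

  +F-identityˡ : ∀ x → 0F +F x ≡ x
  +F-identityˡ x = trans ([]-+ˡ 0 x) ([]-toℕ x)

  +F-identityʳ : ∀ x → x +F 0F ≡ x
  +F-identityʳ x = trans (+F-comm x 0F) (+F-identityˡ x)

  *F-identityˡ : ∀ x → 1F *F x ≡ x
  *F-identityˡ x = trans ([]-*ˡ 1 x) (trans (cong [_] (ℕ.*-identityˡ (toℕ x))) ([]-toℕ x))

  *F-identityʳ : ∀ x → x *F 1F ≡ x
  *F-identityʳ x = trans (*F-comm x 1F) (*F-identityˡ x)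

  negF-inverseʳ : ∀ x → x +F (negF x) ≡ 0F
  negF-inverseʳ x = trans ([]-+ʳ x (p ∸ toℕ x))
    (trans (cong [_] (ℕ.m+[n∸m]≡n (ℕ.<⇒≤ (toℕ<n x)))) ([]-cong-% (trans (n%n≡0 p) (sym 0%p≡0))))

  *F-distribˡ-+F : ∀ x y z → x *F (y +F z) ≡ (x *F y) +F (x *F z)
  *F-distribˡ-+F x y z = trans ([]-*ʳ x (toℕ y ℕ.+ toℕ z))
    (trans (cong [_] (ℕ.*-distribˡ-+ (toℕ x) (toℕ y) (toℕ z))) (sym ([]-+ (toℕ x ℕ.* toℕ y) (toℕ x ℕ.* toℕ z))))

  *F-distribʳ-+F : ∀ x y z → (y +F z) *F x ≡ (y *F x) +F (z *F x)
  *F-distribʳ-+F x y z = trans (*F-comm (y +F z) x)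
    (trans (*F-distribˡ-+F x y z) (cong₂ _+F_ (*F-comm x y) (*F-comm x z)))

  isCommutativeRing : IsCommutativeRing _≡_ _+F_ _*F_ negF 0F 1F
  isCommutativeRing = record
    { isRing = record
      { +-isAbelianGroup = record
        { isGroup = record
          { isMonoid = record
            { isSemigroup = record
              { isMagma = record { isEquivalence = isEquivalence ; ∙-cong = cong₂ _+F_ }
              ; assoc = +F-assoc }
            ; identity = +F-identityˡ , +F-identityʳ }
          ; inverse = (λ x → trans (+F-comm (negF x) x) (negF-inverseʳ x)) , negF-inverseʳ
          ; ⁻¹-cong = cong negF }
        ; comm = +F-comm }
      ; *-cong = cong₂ _*F_
      ; *-assoc = *F-assoc
      ; *-identity = *F-identityˡ , *F-identityʳ
      ; distrib = *F-distribˡ-+F , *F-distribʳ-+F }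
    ; *-comm = *F-comm }

  commutativeRing : CommutativeRing 0ℓ 0ℓ
  commutativeRing = record { isCommutativeRing = isCommutativeRing }

  open CommutativeRing commutativeRing public
    using (_+_; _*_; -_; 0#; 1#; +-comm; +-assoc; +-identityˡ; +-identityʳ; -‿inverseʳ;
           *-comm; *-assoc; *-identityˡ; *-identityʳ; distribˡ; distribʳ; zeroˡ; zeroʳ; semiring; ring)
  open import Algebra.Properties.Ring ring public
    using (-‿distribˡ-*; -‿distribʳ-*; -‿involutive; -‿injective; -0#≈0#; +-inverseʳ-unique; +-inverseˡ-unique)
  open import Algebra.Properties.CommutativeSemigroup
    (CommutativeRing.+-commutativeSemigroup commutativeRing) public using () renaming (interchange to +-interchange)
  open import Algebra.Properties.Semiring.Sum semiring
    using (sum; sum-cong-≗; ∑-distrib-+; *-distribˡ-sum; sum-remove; sum-replicate-zero)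

  ΣF≡sum : ∀ {k} (f : Fin k → F) → ΣF f ≡ sum f
  ΣF≡sum {zero}  f = refl
  ΣF≡sum {suc k} f = cong (f Fin.zero +_) (ΣF≡sum (λ j → f (Fin.suc j)))

  ΣF-cong : ∀ {k} {f g : Fin k → F} → (∀ x → f x ≡ g x) → ΣF f ≡ ΣF g
  ΣF-cong {f = f} {g} f≗g = trans (ΣF≡sum f) (trans (sum-cong-≗ f≗g) (sym (ΣF≡sum g)))

  ΣF-+ : ∀ {k} (f g : Fin k → F) → ΣF (λ x → f x + g x) ≡ ΣF f + ΣF g
  ΣF-+ f g = begin
    ΣF (λ x → f x + g x)   ≡⟨ ΣF≡sum (λ x → f x + g x) ⟩
    sum (λ x → f x + g x)  ≡⟨ ∑-distrib-+ f g ⟩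
    sum f + sum g          ≡⟨ sym (cong₂ _+_ (ΣF≡sum f) (ΣF≡sum g)) ⟩
    ΣF f + ΣF g            ∎
    where open ≡-Reasoning

  ΣF-*ˡ : ∀ {k} c (f : Fin k → F) → ΣF (λ x → c * f x) ≡ c * ΣF f
  ΣF-*ˡ c f = trans (ΣF≡sum (λ x → c * f x))
    (trans (sym (*-distribˡ-sum c f)) (cong (c *_) (sym (ΣF≡sum f))))

  ΣF-zero : ∀ {k} (f : Fin k → F) → (∀ x → f x ≡ 0#) → ΣF f ≡ 0#
  ΣF-zero {k} f f≡0 = trans (ΣF≡sum f) (trans (sum-cong-≗ f≡0) (sum-replicate-zero k))

  ΣF-single : ∀ {k} (j : Fin k) (f : Fin k → F) → (∀ x → x ≢ j → f x ≡ 0#) → ΣF f ≡ f j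
  ΣF-single {suc k} j f f≡0 = begin
    ΣF f                            ≡⟨ ΣF≡sum f ⟩
    sum f                           ≡⟨ sum-remove {i = j} f ⟩
    f j + sum (removeAt f j)        ≡⟨ cong (f j +_) (sym (ΣF≡sum (removeAt f j))) ⟩
    f j + ΣF (removeAt f j)         ≡⟨ cong (f j +_) (ΣF-zero (removeAt f j) (λ x → f≡0 _ (punchInᵢ≢i j x))) ⟩
    f j + 0#                        ≡⟨ +-identityʳ (f j) ⟩
    f j                             ∎
    where open ≡-Reasoning

  ΣF-last : ∀ k (f : Fin (k ℕ.+ 1) → F) → ΣF f ≡ ΣF (λ x → f (x ↑ˡ 1)) + f (k ↑ʳ Fin.zero)
  ΣF-last zero    f = +-comm (f Fin.zero) 0#
  ΣF-last (suc k) f = trans (cong (f Fin.zero +_) (ΣF-last k (λ x → f (Fin.suc x))))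
    (sym (+-assoc (f Fin.zero) (ΣF (λ x → f (Fin.suc (x ↑ˡ 1)))) (f (Fin.suc (k ↑ʳ Fin.zero)))))

  module _ (p-prime : Prime p) where

    1#≢0# : 1# ≢ 0#
    1#≢0# 1≡0 = ℕ.1+n≢0 (begin
      1          ≡⟨ sym (m<n⇒m%n≡m (ℕ.nonTrivial⇒n>1 p {{prime⇒nonTrivial p-prime}})) ⟩
      1 % p      ≡⟨ sym (toℕ-[] 1) ⟩
      toℕ 1#     ≡⟨ cong toℕ 1≡0 ⟩
      toℕ 0#     ≡⟨ toℕ-0F ⟩
      0          ∎)
      where open ≡-Reasoning

    -1#≢0# : - 1# ≢ 0#
    -1#≢0# -1≡0 = 1#≢0# (-‿injective (trans -1≡0 (sym -0#≈0#)))

    p∣toℕ⇒≡0 : ∀ x → p ∣ toℕ x → x ≡ 0#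
    p∣toℕ⇒≡0 x p∣x = toℕ-injective (begin
      toℕ x       ≡⟨ sym (m<n⇒m%n≡m (toℕ<n x)) ⟩
      toℕ x % p   ≡⟨ n∣m⇒m%n≡0 (toℕ x) p p∣x ⟩
      0           ≡⟨ sym toℕ-0F ⟩
      toℕ 0#      ∎)
      where open ≡-Reasoning

    x*y≡0⇒x≡0⊎y≡0 : ∀ x y → x * y ≡ 0# → x ≡ 0# ⊎ y ≡ 0#
    x*y≡0⇒x≡0⊎y≡0 x y xy≡0 =
      Sum.map (p∣toℕ⇒≡0 x) (p∣toℕ⇒≡0 y) (euclidsLemma (toℕ x) (toℕ y) p-prime p∣xy)
      where
      p∣xy : p ∣ toℕ x ℕ.* toℕ y
      p∣xy = m%n≡0⇒n∣m _ p (trans (sym (toℕ-[] _)) (trans (cong toℕ xy≡0) toℕ-0F))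

    *-nonZero : ∀ {x y} → x ≢ 0# → y ≢ 0# → x * y ≢ 0#
    *-nonZero x≢0 y≢0 xy≡0 = Sum.[ x≢0 , y≢0 ] (x*y≡0⇒x≡0⊎y≡0 _ _ xy≡0)

module KernelVectors (p : ℕ) .{{_ : NonZero p}} (p-prime : Prime p) where
  open GF p using (F; Mat; ΣF; Dependent; Circuit; Simple)
  open GF-Ring p

  _∈Ker_ : {m k : ℕ} → (Fin k → F) → Mat m k → Set
  c ∈Ker A = ∀ i → ΣF (λ j → c j * A i j) ≡ 0#

  SupportedIn : {k : ℕ} → (Fin k → F) → Subset k → Set
  SupportedIn c S = ∀ j → c j ≢ 0# → j ∈ S

  _≼_ : {k : ℕ} → (Fin k → F) → (Fin k → F) → Set
  t ≼ d = ∀ y → d y ≡ 0# → t y ≡ 0#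

  support : {k : ℕ} → (Fin k → F) → Subset k
  support t = tabulate (λ y → does (¬? (t y ≟ 0#)))

  ∈support⁺ : ∀ {k} (t : Fin k → F) → SupportedIn t (support t)
  ∈support⁺ t y ty≢0 = lookup⇒[]= y (support t)
    (trans (lookup∘tabulate _ y) (dec-true (¬? (t y ≟ 0#)) ty≢0))

  ∈support⁻ : ∀ {k} (t : Fin k → F) {y} → y ∈ support t → t y ≢ 0#
  ∈support⁻ t {y} y∈ ty≡0 = contradiction
    (trans (sym ([]=⇒lookup y∈)) (trans (lookup∘tabulate _ y) (dec-false (¬? (t y ≟ 0#)) (λ ty≢0 → ty≢0 ty≡0))))
    λ ()

  SupportedIn⇒∉⇒≡0 : ∀ {k} {t : Fin k → F} {S} → SupportedIn t S → ∀ {y} → y ∉ S → t y ≡ 0#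
  SupportedIn⇒∉⇒≡0 {t = t} t⊆S {y} y∉S with t y ≟ 0#
  ... | yes ty≡0 = ty≡0
  ... | no ty≢0  = contradiction (t⊆S y ty≢0) y∉S

  elim-≟ : ∀ {k ℓ} {P : Fin k → Set ℓ} j → (∀ x → x ≢ j → P x) → P j → ∀ x → P x
  elim-≟ j other at-j x with x ≟ j
  ... | yes refl = at-j
  ... | no x≢j   = other x x≢j

  [_↦_] : ∀ {k} → Fin k → F → Fin k → F
  [ j ↦ c ] x with x ≟ j
  ... | yes _ = c
  ... | no _  = 0#

  [↦]-same : ∀ {k} (j : Fin k) c → [ j ↦ c ] j ≡ c
  [↦]-same j c with j ≟ j
  ... | yes _  = refl
  ... | no j≢j = contradiction refl j≢j

  [↦]-other : ∀ {k} {j x : Fin k} c → x ≢ j → [ j ↦ c ] x ≡ 0#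
  [↦]-other {j = j} {x} c x≢j with x ≟ j
  ... | yes x≡j = contradiction x≡j x≢j
  ... | no _    = refl

  [↦0#] : ∀ {k} (j x : Fin k) → [ j ↦ 0# ] x ≡ 0#
  [↦0#] j x with x ≟ j
  ... | yes _ = refl
  ... | no _  = refl

  ΣF-[↦] : ∀ {k} (j : Fin k) c (f : Fin k → F) → ΣF (λ x → f x * [ j ↦ c ] x) ≡ f j * c
  ΣF-[↦] j c f = trans (ΣF-single j (λ x → f x * [ j ↦ c ] x)
                         (λ x x≢j → trans (cong (f x *_) ([↦]-other c x≢j)) (zeroʳ (f x))))
                       (cong (f j *_) ([↦]-same j c))

  erase : ∀ {k} → Fin k → (Fin k → F) → Fin k → F
  erase j c x with x ≟ j
  ... | yes _ = 0#
  ... | no _  = c x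

  erase-same : ∀ {k} (j : Fin k) c → erase j c j ≡ 0#
  erase-same j c with j ≟ j
  ... | yes _  = refl
  ... | no j≢j = contradiction refl j≢j

  erase-other : ∀ {k} {j x : Fin k} c → x ≢ j → erase j c x ≡ c x
  erase-other {j = j} {x} c x≢j with x ≟ j
  ... | yes x≡j = contradiction x≡j x≢j
  ... | no _    = refl

  erase+[↦] : ∀ {k} (j : Fin k) c x → erase j c x + [ j ↦ c j ] x ≡ c x
  erase+[↦] j c x with x ≟ j
  ... | yes refl = +-identityˡ (c x)
  ... | no _     = +-identityʳ (c x)

  module _ {m k : ℕ} (A : Mat m k) where

    ∈Ker-cong : ∀ {s t} → (∀ x → s x ≡ t x) → s ∈Ker A → t ∈Ker A
    ∈Ker-cong s≗t s∈Ker i = trans (ΣF-cong (λ x → cong (_* A i x) (sym (s≗t x)))) (s∈Ker i)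

    ∈Ker-lincomb : ∀ κ ν {s t} → s ∈Ker A → t ∈Ker A → (λ x → κ * s x + ν * t x) ∈Ker A
    ∈Ker-lincomb κ ν {s} {t} s∈Ker t∈Ker i = begin
      ΣF (λ x → (κ * s x + ν * t x) * A i x)
        ≡⟨ ΣF-cong (λ x → trans (distribʳ (A i x) (κ * s x) (ν * t x))
                                (cong₂ _+_ (*-assoc κ (s x) (A i x)) (*-assoc ν (t x) (A i x)))) ⟩
      ΣF (λ x → κ * (s x * A i x) + ν * (t x * A i x))
        ≡⟨ ΣF-+ (λ x → κ * (s x * A i x)) (λ x → ν * (t x * A i x)) ⟩
      ΣF (λ x → κ * (s x * A i x)) + ΣF (λ x → ν * (t x * A i x))
        ≡⟨ cong₂ _+_ (ΣF-*ˡ κ (λ x → s x * A i x)) (ΣF-*ˡ ν (λ x → t x * A i x)) ⟩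
      κ * ΣF (λ x → s x * A i x) + ν * ΣF (λ x → t x * A i x)
        ≡⟨ cong₂ (λ u v → κ * u + ν * v) (s∈Ker i) (t∈Ker i) ⟩
      κ * 0# + ν * 0#
        ≡⟨ cong₂ _+_ (zeroʳ κ) (zeroʳ ν) ⟩
      0# + 0#
        ≡⟨ +-identityʳ 0# ⟩
      0# ∎
      where open ≡-Reasoning

    ≡0⇒∈Ker : ∀ {c} → (∀ x → c x ≡ 0#) → c ∈Ker A
    ≡0⇒∈Ker c≡0 i = ΣF-zero _ (λ x → trans (cong (_* A i x) (c≡0 x)) (zeroˡ (A i x)))

    circuit-vector-nonzero : ∀ {C c j} → Circuit A C → c ∈Ker A → SupportedIn c C → c j ≢ 0# →
                             ∀ u → u ∈ C → c u ≢ 0#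
    circuit-vector-nonzero {c = c} {j} (_ , minimal) c∈Ker c⊆C cj≢0 u u∈C cu≡0 =
      minimal (support c) ((λ x∈ → c⊆C _ (∈support⁻ c x∈)) , u , u∈C , (λ u∈ → ∈support⁻ c u∈ cu≡0))
              (c , ∈support⁺ c , (j , cj≢0) , c∈Ker)

    circuit-vector-vanishes : ∀ {C c j} → Circuit A C → c ∈Ker A → SupportedIn c C → j ∈ C → c j ≡ 0# →
                              ∀ x → c x ≡ 0#
    circuit-vector-vanishes {c = c} circuit c∈Ker c⊆C j∈C cj≡0 x with c x ≟ 0#
    ... | yes cx≡0 = cx≡0
    ... | no cx≢0  = contradiction cj≡0 (circuit-vector-nonzero circuit c∈Ker c⊆C cx≢0 _ j∈C)

    proportional⇒circuit : ∀ {d j} → d ∈Ker A → d j ≢ 0# →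
      (∀ t → t ∈Ker A → t ≼ d → ∃₂ λ κ ν → κ ≢ 0# × (∀ y → κ * t y ≡ ν * d y)) →
      Circuit A (support d)
    proportional⇒circuit {d} {j} d∈Ker dj≢0 proportional = (d , ∈support⁺ d , (j , dj≢0) , d∈Ker) , minimal
      where
      minimal : ∀ T → T ⊂ support d → ¬ Dependent A T
      minimal T (T⊆ , y₀ , y₀∈ , y₀∉T) (t , t⊆T , (y₁ , ty₁≢0) , t∈Ker)
        with proportional t t∈Ker (λ y dy≡0 → SupportedIn⇒∉⇒≡0 t⊆T (λ y∈T → ∈support⁻ d (T⊆ y∈T) dy≡0))
      ... | κ , ν , κ≢0 , κt≡νd with ν ≟ 0#
      ...   | yes ν≡0 = *-nonZero p-prime κ≢0 ty₁≢0 (trans (κt≡νd y₁) (trans (cong (_* d y₁) ν≡0) (zeroˡ (d y₁))))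
      ...   | no ν≢0  = y₀∉T (t⊆T y₀ λ ty₀≡0 → *-nonZero p-prime ν≢0 (∈support⁻ d y₀∈)
                          (trans (sym (κt≡νd y₀)) (trans (cong (κ *_) ty₀≡0) (zeroʳ κ))))

    simple⇒loopless : Simple A → ∀ {c} j → c ∈Ker A → (∀ x → x ≢ j → c x ≡ 0#) → c j ≡ 0#
    simple⇒loopless simple {c} j c∈Ker c≡0 with c j ≟ 0#
    ... | yes cj≡0 = cj≡0
    ... | no cj≢0  = contradiction (subst (2 ℕ.<_) (∣⁅x⁆∣≡1 j) (simple ⁅ j ⁆ (dependent , minimal))) λ { (ℕ.s≤s ()) }
      where
      c⊆⁅j⁆ : SupportedIn c ⁅ j ⁆
      c⊆⁅j⁆ x cx≢0 with x ≟ j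
      ... | yes refl = x∈⁅x⁆ j
      ... | no x≢j   = contradiction (c≡0 x x≢j) cx≢0

      dependent : Dependent A ⁅ j ⁆
      dependent = c , c⊆⁅j⁆ , (j , cj≢0) , c∈Ker

      minimal : ∀ T → T ⊂ ⁅ j ⁆ → ¬ Dependent A T
      minimal T (T⊆ , y , y∈⁅j⁆ , y∉T) (t , t⊆T , (x , tx≢0) , _) =
        y∉T (subst (_∈ T) (trans (x∈⁅y⁆⇒x≡y j (T⊆ x∈T)) (sym (x∈⁅y⁆⇒x≡y j y∈⁅j⁆))) x∈T)
        where
        x∈T = t⊆T x tx≢0

module Splitting (p : ℕ) .{{_ : NonZero p}} (p-prime : Prime p)
  {m n : ℕ} (A : GF.Mat p m n) (a b : Fin n) (a≢b : a ≢ b)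
  (α : Fin p) (α≢0 : α ≢ GF.0F p) (e : Fin n) (e∈ab : e ≡ a ⊎ e ≡ b) where
  open GF p using (F; Mat; ΣF; _-F_; Circuit; Simple; Connected; A′; Ae; zcol; embE)
  open GF-Ring p
  open KernelVectors p p-prime

  K : ℕ
  K = (n ℕ.+ 1) ℕ.+ 1

  B : Mat (m ℕ.+ 1) K
  B = Ae A a b α e

  ι : Fin n → Fin K
  ι x = embE x ↑ˡ 1

  z γ : Fin K
  z = zcol ↑ˡ 1
  γ = (n ℕ.+ 1) ↑ʳ Fin.zero

  old : Fin m → Fin (m ℕ.+ 1)
  old i = i ↑ˡ 1

  new : Fin (m ℕ.+ 1)
  new = m ↑ʳ Fin.zero

  data Column : Fin K → Set where
    ι-col : ∀ x → Column (ι x)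
    z-col : Column z
    γ-col : Column γ

  column : ∀ y → Column y
  column y with splitAt (n ℕ.+ 1) y in eq
  ... | inj₂ Fin.zero = subst Column (splitAt⁻¹-↑ʳ eq) γ-col
  ... | inj₁ y′ with splitAt n y′ in eq′
  ...   | inj₁ x        = subst Column (trans (cong (_↑ˡ 1) (splitAt⁻¹-↑ˡ eq′)) (splitAt⁻¹-↑ˡ eq)) (ι-col x)
  ...   | inj₂ Fin.zero = subst Column (trans (cong (_↑ˡ 1) (splitAt⁻¹-↑ʳ eq′)) (splitAt⁻¹-↑ˡ eq)) z-col

  data Row : Fin (m ℕ.+ 1) → Set where
    old-row : ∀ i → Row (old i)
    new-row : Row new

  row : ∀ r → Row r
  row r with splitAt m r in eq
  ... | inj₁ i        = subst Row (splitAt⁻¹-↑ˡ eq) (old-row i)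
  ... | inj₂ Fin.zero = subst Row (splitAt⁻¹-↑ʳ eq) new-row

  B-old-ι : ∀ i x → B (old i) (ι x) ≡ A i x
  B-old-ι i x rewrite splitAt-↑ˡ (n ℕ.+ 1) (x ↑ˡ 1) 1 | splitAt-↑ˡ m i 1 | splitAt-↑ˡ n x 1 = refl

  B-old-z : ∀ i → B (old i) z ≡ 0#
  B-old-z i rewrite splitAt-↑ˡ (n ℕ.+ 1) (zcol {n}) 1 | splitAt-↑ˡ m i 1 | splitAt-↑ʳ n 1 Fin.zero = refl

  B-old-γ : ∀ i → B (old i) γ ≡ A i e
  B-old-γ i rewrite splitAt-↑ʳ (n ℕ.+ 1) 1 Fin.zero | splitAt-↑ˡ m i 1 | splitAt-↑ʳ n 1 Fin.zero | splitAt-↑ˡ n e 1 =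
    trans (-F≡+negF (A i e) 0#) (trans (cong (A i e +_) -0#≈0#) (+-identityʳ (A i e)))

  B-new-ι : ∀ x → B new (ι x) ≡ [ a ↦ α ] x + [ b ↦ α ] x
  B-new-ι x rewrite splitAt-↑ˡ (n ℕ.+ 1) (x ↑ˡ 1) 1 | splitAt-↑ʳ m 1 Fin.zero | splitAt-↑ˡ n x 1
    with x ≟ a | x ≟ b
  ... | yes x≡a | yes x≡b = contradiction (trans (sym x≡a) x≡b) a≢b
  ... | yes _   | no _    = sym (+-identityʳ α)
  ... | no _    | yes _   = sym (+-identityˡ α)
  ... | no _    | no _    = sym (+-identityˡ 0#)

  B-new-z : B new z ≡ α
  B-new-z rewrite splitAt-↑ˡ (n ℕ.+ 1) (zcol {n}) 1 | splitAt-↑ʳ m 1 Fin.zero | splitAt-↑ʳ n 1 Fin.zero = refl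

  B-new-γ : B new γ ≡ 0#
  B-new-γ rewrite splitAt-↑ʳ (n ℕ.+ 1) 1 Fin.zero =
    trans (cong₂ _-F_ A′-new-e A′-new-z) (trans (-F≡+negF α α) (-‿inverseʳ α))
    where
    A′-new-e : A′ A a b α new (embE e) ≡ α
    A′-new-e rewrite splitAt-↑ʳ m 1 Fin.zero | splitAt-↑ˡ n e 1 with e ≟ a | e ≟ b
    ... | yes _  | _      = refl
    ... | no _   | yes _  = refl
    ... | no e≢a | no e≢b = contradiction e∈ab [ e≢a , e≢b ]′

    A′-new-z : A′ A a b α new (zcol {n}) ≡ α
    A′-new-z rewrite splitAt-↑ʳ m 1 Fin.zero | splitAt-↑ʳ n 1 Fin.zero = refl

  ΣF-columns : ∀ (t : Fin K → F) r → ΣF (λ y → t y * B r y) ≡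
    ΣF (λ x → t (ι x) * B r (ι x)) + t z * B r z + t γ * B r γ
  ΣF-columns t r = trans (ΣF-last (n ℕ.+ 1) (λ y → t y * B r y))
    (cong (_+ t γ * B r γ) (ΣF-last n (λ y → t (y ↑ˡ 1) * B r (y ↑ˡ 1))))

  -- γ agrees with e on the rows of A, so there only the sum of their coefficients matters.
  collapse : (Fin K → F) → Fin n → F
  collapse t x = t (ι x) + [ e ↦ t γ ] x

  newRowSum : (Fin K → F) → F
  newRowSum t = t (ι a) + t (ι b) + t z

  ΣF-old-row : ∀ t i → ΣF (λ y → t y * B (old i) y) ≡ ΣF (λ x → collapse t x * A i x)
  ΣF-old-row t i = begin
    ΣF (λ y → t y * B (old i) y)
      ≡⟨ ΣF-columns t (old i) ⟩
    ΣF (λ x → t (ι x) * B (old i) (ι x)) + t z * B (old i) z + t γ * B (old i) γ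
      ≡⟨ cong₂ _+_ (cong₂ _+_ (ΣF-cong (λ x → cong (t (ι x) *_) (B-old-ι i x)))
                              (trans (cong (t z *_) (B-old-z i)) (zeroʳ (t z))))
                   (cong (t γ *_) (B-old-γ i)) ⟩
    ΣF (λ x → t (ι x) * A i x) + 0# + t γ * A i e
      ≡⟨ cong₂ _+_ (+-identityʳ _) (sym (trans (ΣF-cong (λ x → *-comm ([ e ↦ t γ ] x) (A i x)))
                                              (trans (ΣF-[↦] e (t γ) (A i)) (*-comm (A i e) (t γ))))) ⟩
    ΣF (λ x → t (ι x) * A i x) + ΣF (λ x → [ e ↦ t γ ] x * A i x)
      ≡⟨ sym (ΣF-+ (λ x → t (ι x) * A i x) (λ x → [ e ↦ t γ ] x * A i x)) ⟩
    ΣF (λ x → t (ι x) * A i x + [ e ↦ t γ ] x * A i x)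
      ≡⟨ ΣF-cong (λ x → sym (distribʳ (A i x) (t (ι x)) ([ e ↦ t γ ] x))) ⟩
    ΣF (λ x → collapse t x * A i x) ∎
    where open ≡-Reasoning

  ΣF-new-row : ∀ t → ΣF (λ y → t y * B new y) ≡ newRowSum t * α
  ΣF-new-row t = begin
    ΣF (λ y → t y * B new y)
      ≡⟨ ΣF-columns t new ⟩
    ΣF (λ x → t (ι x) * B new (ι x)) + t z * B new z + t γ * B new γ
      ≡⟨ cong₂ _+_ (cong₂ _+_ (ΣF-cong (λ x → trans (cong (t (ι x) *_) (B-new-ι x))
                                                    (distribˡ (t (ι x)) ([ a ↦ α ] x) ([ b ↦ α ] x))))
                              (cong (t z *_) B-new-z))
                   (trans (cong (t γ *_) B-new-γ) (zeroʳ (t γ))) ⟩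
    ΣF (λ x → t (ι x) * [ a ↦ α ] x + t (ι x) * [ b ↦ α ] x) + t z * α + 0#
      ≡⟨ +-identityʳ _ ⟩
    ΣF (λ x → t (ι x) * [ a ↦ α ] x + t (ι x) * [ b ↦ α ] x) + t z * α
      ≡⟨ cong (_+ t z * α) (trans (ΣF-+ (λ x → t (ι x) * [ a ↦ α ] x) (λ x → t (ι x) * [ b ↦ α ] x))
                                  (cong₂ _+_ (ΣF-[↦] a α (λ x → t (ι x))) (ΣF-[↦] b α (λ x → t (ι x))))) ⟩
    t (ι a) * α + t (ι b) * α + t z * α
      ≡⟨ cong (_+ t z * α) (sym (distribʳ α (t (ι a)) (t (ι b)))) ⟩
    (t (ι a) + t (ι b)) * α + t z * α
      ≡⟨ sym (distribʳ α (t (ι a) + t (ι b)) (t z)) ⟩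
    newRowSum t * α ∎
    where open ≡-Reasoning

  ∈Ker-B⁺ : ∀ {t} → collapse t ∈Ker A → newRowSum t ≡ 0# → t ∈Ker B
  ∈Ker-B⁺ {t} old-rows new-row-sum r with row r
  ... | old-row i = trans (ΣF-old-row t i) (old-rows i)
  ... | new-row   = trans (ΣF-new-row t) (trans (cong (_* α) new-row-sum) (zeroˡ α))

  ∈Ker-B⁻ : ∀ t → t ∈Ker B → collapse t ∈Ker A × newRowSum t ≡ 0#
  ∈Ker-B⁻ t t∈Ker =
    (λ i → trans (sym (ΣF-old-row t i)) (t∈Ker (old i))) ,
    Sum.[ (λ s≡0 → s≡0) , (λ α≡0 → contradiction α≡0 α≢0) ]′
      (x*y≡0⇒x≡0⊎y≡0 p-prime (newRowSum t) α (trans (sym (ΣF-new-row t)) (t∈Ker new)))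

  ⟦_,_,_⟧ : (Fin n → F) → F → F → Fin K → F
  ⟦ v , ζ , g ⟧ y with splitAt (n ℕ.+ 1) y
  ... | inj₂ _  = g
  ... | inj₁ y′ with splitAt n y′
  ...   | inj₁ x = v x
  ...   | inj₂ _ = ζ

  ⟦⟧-ι : ∀ v ζ g x → ⟦ v , ζ , g ⟧ (ι x) ≡ v x
  ⟦⟧-ι v ζ g x rewrite splitAt-↑ˡ (n ℕ.+ 1) (x ↑ˡ 1) 1 | splitAt-↑ˡ n x 1 = refl

  ⟦⟧-z : ∀ v ζ g → ⟦ v , ζ , g ⟧ z ≡ ζ
  ⟦⟧-z v ζ g rewrite splitAt-↑ˡ (n ℕ.+ 1) (zcol {n}) 1 | splitAt-↑ʳ n 1 Fin.zero = refl

  ⟦⟧-γ : ∀ v ζ g → ⟦ v , ζ , g ⟧ γ ≡ g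
  ⟦⟧-γ v ζ g rewrite splitAt-↑ʳ (n ℕ.+ 1) 1 Fin.zero = refl

  -- the z-coefficient is forced by the new row
  extend : (Fin n → F) → F → Fin K → F
  extend v g = ⟦ v , - (v a + v b) , g ⟧

  collapse-extend : ∀ v g x → collapse (extend v g) x ≡ v x + [ e ↦ g ] x
  collapse-extend v g x = cong₂ (λ u g′ → u + [ e ↦ g′ ] x) (⟦⟧-ι v _ g x) (⟦⟧-γ v _ g)

  extend∈Ker : ∀ v g → (λ x → v x + [ e ↦ g ] x) ∈Ker A → extend v g ∈Ker B
  extend∈Ker v g v+g∈Ker = ∈Ker-B⁺ {extend v g} (∈Ker-cong A (λ x → sym (collapse-extend v g x)) v+g∈Ker)
    (trans (cong₂ _+_ (cong₂ _+_ (⟦⟧-ι v _ g a) (⟦⟧-ι v _ g b)) (⟦⟧-z v _ g))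
           (-‿inverseʳ (v a + v b)))

  ι∈support-extend : ∀ {v x} g → v x ≢ 0# → ι x ∈ support (extend v g)
  ι∈support-extend {v} {x} g vx≢0 = ∈support⁺ (extend v g) (ι x) (λ ≡0 → vx≢0 (trans (sym (⟦⟧-ι v _ g x)) ≡0))

  z∈support-extend : ∀ {v} g → v a + v b ≢ 0# → z ∈ support (extend v g)
  z∈support-extend {v} g sum≢0 = ∈support⁺ (extend v g) z
    (λ ≡0 → sum≢0 (-‿injective (trans (sym (⟦⟧-z v _ g)) (trans ≡0 (sym -0#≈0#)))))

  γ∈support-extend : ∀ {v g} → g ≢ 0# → γ ∈ support (extend v g)
  γ∈support-extend {v} {g} g≢0 = ∈support⁺ (extend v g) γ (λ ≡0 → g≢0 (trans (sym (⟦⟧-γ v _ g)) ≡0))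

  collapse-≢e : ∀ s {x} → x ≢ e → collapse s x ≡ s (ι x)
  collapse-≢e s {x} x≢e = trans (cong (s (ι x) +_) ([↦]-other (s γ) x≢e)) (+-identityʳ (s (ι x)))

  collapse-e : ∀ s → collapse s e ≡ s (ι e) + s γ
  collapse-e s = cong (s (ι e) +_) ([↦]-same e (s γ))

  collapse-e-ι : ∀ s → s γ ≡ 0# → collapse s e ≡ s (ι e)
  collapse-e-ι s sγ≡0 = trans (collapse-e s) (trans (cong (s (ι e) +_) sγ≡0) (+-identityʳ (s (ι e))))

  collapse-e-γ : ∀ s → s (ι e) ≡ 0# → collapse s e ≡ s γ
  collapse-e-γ s sιe≡0 = trans (collapse-e s) (trans (cong (_+ s γ) sιe≡0) (+-identityˡ (s γ)))

  -- If d is separated, collapse d loses no information about d.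
  Separated : (Fin K → F) → Set
  Separated d = d (ι e) ≡ 0# ⊎ d γ ≡ 0#

  collapse-≼ : ∀ {t d} → Separated d → t ≼ d → collapse t ≼ collapse d
  collapse-≼ {t} {d} sep t≼d = elim-≟ e at-other at-e
    where
    at-other : ∀ x → x ≢ e → collapse d x ≡ 0# → collapse t x ≡ 0#
    at-other x x≢e cdx≡0 = trans (collapse-≢e t x≢e) (t≼d (ι x) (trans (sym (collapse-≢e d x≢e)) cdx≡0))

    at-e : collapse d e ≡ 0# → collapse t e ≡ 0#
    at-e cde≡0 = Sum.[
      (λ dιe≡0 → trans (collapse-e-γ t (t≼d (ι e) dιe≡0)) (t≼d γ (trans (sym (collapse-e-γ d dιe≡0)) cde≡0))) ,
      (λ dγ≡0 → trans (collapse-e-ι t (t≼d γ dγ≡0)) (t≼d (ι e) (trans (sym (collapse-e-ι d dγ≡0)) cde≡0))) ]′ sep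

  collapse≢0⇒≢0 : ∀ {d x} → collapse d x ≢ 0# → ∃ λ y → d y ≢ 0#
  collapse≢0⇒≢0 {d} {x} cdx≢0 with d (ι x) ≟ 0# | d γ ≟ 0#
  ... | no dιx≢0  | _        = ι x , dιx≢0
  ... | yes _     | no dγ≢0  = γ , dγ≢0
  ... | yes dιx≡0 | yes dγ≡0 = contradiction
    (trans (cong₂ _+_ dιx≡0 (trans (cong (λ g → [ e ↦ g ] x) dγ≡0) ([↦0#] e x))) (+-identityˡ 0#)) cdx≢0

  module _ {t d : Fin K → F} {κ ν : F} (sep : Separated d) (t≼d : t ≼ d) (t∈Ker : t ∈Ker B) (d∈Ker : d ∈Ker B)
           (κct≡νcd : ∀ x → κ * collapse t x ≡ ν * collapse d x) where

    private
      both-zero : ∀ y → d y ≡ 0# → κ * t y ≡ ν * d y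
      both-zero y dy≡0 = trans (cong (κ *_) (t≼d y dy≡0)) (trans (zeroʳ κ) (sym (trans (cong (ν *_) dy≡0) (zeroʳ ν))))

      via-collapse : ∀ {x} y → (∀ s → s ≼ d → collapse s x ≡ s y) → κ * t y ≡ ν * d y
      via-collapse {x} y collapse≡ = trans (cong (κ *_) (sym (collapse≡ t t≼d)))
                                       (trans (κct≡νcd x) (cong (ν *_) (collapse≡ d (λ _ dy≡0 → dy≡0))))

      proportional-ι : ∀ x → κ * t (ι x) ≡ ν * d (ι x)
      proportional-ι = elim-≟ e (λ x x≢e → via-collapse (ι x) (λ s _ → collapse-≢e s x≢e)) (Sum.[
        both-zero (ι e) ,
        (λ dγ≡0 → via-collapse (ι e) (λ s s≼d → collapse-e-ι s (s≼d γ dγ≡0))) ]′ sep)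

      proportional-γ : κ * t γ ≡ ν * d γ
      proportional-γ = Sum.[
        (λ dιe≡0 → via-collapse γ (λ s s≼d → collapse-e-γ s (s≼d (ι e) dιe≡0))) ,
        both-zero γ ]′ sep

      z-coefficient : ∀ s → s ∈Ker B → s z ≡ - (s (ι a) + s (ι b))
      z-coefficient s s∈Ker = +-inverseʳ-unique (s (ι a) + s (ι b)) (s z) (proj₂ (∈Ker-B⁻ s s∈Ker))

      proportional-z : κ * t z ≡ ν * d z
      proportional-z = begin
        κ * t z                             ≡⟨ cong (κ *_) (z-coefficient t t∈Ker) ⟩
        κ * - (t (ι a) + t (ι b))           ≡⟨ sym (-‿distribʳ-* κ _) ⟩
        - (κ * (t (ι a) + t (ι b)))         ≡⟨ cong -_ (distribˡ κ (t (ι a)) (t (ι b))) ⟩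
        - (κ * t (ι a) + κ * t (ι b))       ≡⟨ cong -_ (cong₂ _+_ (proportional-ι a) (proportional-ι b)) ⟩
        - (ν * d (ι a) + ν * d (ι b))       ≡⟨ cong -_ (sym (distribˡ ν (d (ι a)) (d (ι b)))) ⟩
        - (ν * (d (ι a) + d (ι b)))         ≡⟨ -‿distribʳ-* ν _ ⟩
        ν * - (d (ι a) + d (ι b))           ≡⟨ cong (ν *_) (sym (z-coefficient d d∈Ker)) ⟩
        ν * d z                             ∎
        where open ≡-Reasoning

    collapse-proportional⇒proportional : ∀ y → κ * t y ≡ ν * d y
    collapse-proportional⇒proportional y with column y
    ... | ι-col x = proportional-ι x
    ... | z-col   = proportional-z
    ... | γ-col   = proportional-γ

  circuit-lift : ∀ {C d j} → Circuit A C → d ∈Ker B → SupportedIn (collapse d) C → collapse d j ≢ 0# →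
                 Separated d → Circuit B (support d)
  circuit-lift {C} {d} {j} circuit d∈Ker cd⊆C cdj≢0 sep =
    proportional⇒circuit B {d} d∈Ker (proj₂ (collapse≢0⇒≢0 {d} cdj≢0)) proportional
    where
    proportional : ∀ t → t ∈Ker B → t ≼ d → ∃₂ λ κ ν → κ ≢ 0# × (∀ y → κ * t y ≡ ν * d y)
    proportional t t∈Ker t≼d =
      κ , ν , cdj≢0 , collapse-proportional⇒proportional {t} {d} {κ} {ν} sep t≼d t∈Ker d∈Ker κct≡νcd
      where
      κ ν : F
      κ = collapse d j
      ν = collapse t j

      -- a kernel vector of A inside the circuit C vanishing at j, hence zero
      w : Fin n → F
      w x = κ * collapse t x + - ν * collapse d x

      w∈Ker : w ∈Ker A
      w∈Ker = ∈Ker-lincomb A κ (- ν) (proj₁ (∈Ker-B⁻ t t∈Ker)) (proj₁ (∈Ker-B⁻ d d∈Ker))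

      w⊆C : SupportedIn w C
      w⊆C x wx≢0 with collapse d x ≟ 0#
      ... | no cdx≢0  = cd⊆C x cdx≢0
      ... | yes cdx≡0 = contradiction (trans (cong₂ (λ u v → κ * u + - ν * v) (collapse-≼ sep t≼d x cdx≡0) cdx≡0)
                                      (trans (cong₂ _+_ (zeroʳ κ) (zeroʳ (- ν))) (+-identityʳ 0#))) wx≢0

      wj≡0 : w j ≡ 0#
      wj≡0 = trans (cong (κ * ν +_) (trans (sym (-‿distribˡ-* ν κ)) (cong -_ (*-comm ν κ)))) (-‿inverseʳ (κ * ν))

      κct≡νcd : ∀ x → κ * collapse t x ≡ ν * collapse d x
      κct≡νcd x = trans (+-inverseˡ-unique _ _ (circuit-vector-vanishes A circuit w∈Ker w⊆C (cd⊆C j cdj≢0) wj≡0 x))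
                        (trans (cong -_ (sym (-‿distribˡ-* ν (collapse d x)))) (-‿involutive (ν * collapse d x)))

  ab-sum : ∀ f → (∀ x → x ≢ e → f x ≡ 0#) → f a + f b ≡ f e
  ab-sum f f≡0 = Sum.[ e≡a⇒ , e≡b⇒ ]′ e∈ab
    where
    e≡a⇒ : e ≡ a → f a + f b ≡ f e
    e≡a⇒ e≡a = trans (cong (f a +_) (f≡0 b (λ b≡e → a≢b (trans (sym e≡a) (sym b≡e)))))
                     (trans (+-identityʳ (f a)) (cong f (sym e≡a)))

    e≡b⇒ : e ≡ b → f a + f b ≡ f e
    e≡b⇒ e≡b = trans (cong (_+ f b) (f≡0 a (λ a≡e → a≢b (trans a≡e e≡b))))
                     (trans (+-identityˡ (f b)) (cong f (sym e≡b)))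

  τ : Fin K → F
  τ = extend [ e ↦ 1# ] (- 1#)

  τ-ι : ∀ x → τ (ι x) ≡ [ e ↦ 1# ] x
  τ-ι = ⟦⟧-ι [ e ↦ 1# ] _ (- 1#)

  τ-ιe : τ (ι e) ≡ 1#
  τ-ιe = trans (τ-ι e) ([↦]-same e 1#)

  τ-z : τ z ≡ - 1#
  τ-z = trans (⟦⟧-z [ e ↦ 1# ] _ (- 1#))
              (cong -_ (trans (ab-sum [ e ↦ 1# ] (λ x → [↦]-other 1#)) ([↦]-same e 1#)))

  τ-γ : τ γ ≡ - 1#
  τ-γ = ⟦⟧-γ [ e ↦ 1# ] _ (- 1#)

  τ∈Ker : τ ∈Ker B
  τ∈Ker = extend∈Ker [ e ↦ 1# ] (- 1#) (≡0⇒∈Ker A (elim-≟ e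
    (λ x x≢e → trans (cong₂ _+_ ([↦]-other 1# x≢e) ([↦]-other (- 1#) x≢e)) (+-identityʳ 0#))
    (trans (cong₂ _+_ ([↦]-same e 1#) ([↦]-same e (- 1#))) (-‿inverseʳ 1#))))

  -- τ = ι e - z - γ: on the rows of A the columns e, z, γ are A e, 0, A e, and on the new row α, α, 0.
  triangle : Simple A → Circuit B (support τ)
  triangle simple = proportional⇒circuit B {τ} τ∈Ker (λ τιe≡0 → 1#≢0# p-prime (trans (sym τ-ιe) τιe≡0)) proportional
    where
    proportional : ∀ t → t ∈Ker B → t ≼ τ → ∃₂ λ κ ν → κ ≢ 0# × (∀ y → κ * t y ≡ ν * τ y)
    proportional t t∈Ker t≼τ = 1# , t (ι e) , 1#≢0# p-prime , scaled
      where
      off-e : ∀ x → x ≢ e → t (ι x) ≡ 0#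
      off-e x x≢e = t≼τ (ι x) (trans (τ-ι x) ([↦]-other 1# x≢e))

      tιe+tγ≡0 : t (ι e) + t γ ≡ 0#
      tιe+tγ≡0 = trans (sym (collapse-e t)) (simple⇒loopless A simple e (proj₁ (∈Ker-B⁻ t t∈Ker))
                   (λ x x≢e → trans (collapse-≢e t x≢e) (off-e x x≢e)))

      tιe+tz≡0 : t (ι e) + t z ≡ 0#
      tιe+tz≡0 = trans (cong (_+ t z) (sym (ab-sum (λ x → t (ι x)) off-e))) (proj₂ (∈Ker-B⁻ t t∈Ker))

      negated : ∀ {s} → t (ι e) + s ≡ 0# → 1# * s ≡ t (ι e) * - 1#
      negated {s} h = trans (*-identityˡ s) (trans (+-inverseʳ-unique _ _ h)
                        (trans (cong -_ (sym (*-identityʳ (t (ι e))))) (-‿distribʳ-* (t (ι e)) 1#)))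

      scaled-ι : ∀ x → 1# * t (ι x) ≡ t (ι e) * τ (ι x)
      scaled-ι = elim-≟ e
        (λ x x≢e → trans (cong (1# *_) (off-e x x≢e)) (trans (zeroʳ 1#)
                     (sym (trans (cong (t (ι e) *_) (trans (τ-ι x) ([↦]-other 1# x≢e))) (zeroʳ (t (ι e)))))))
        (trans (*-identityˡ (t (ι e))) (sym (trans (cong (t (ι e) *_) τ-ιe) (*-identityʳ (t (ι e))))))

      scaled : ∀ y → 1# * t y ≡ t (ι e) * τ y
      scaled y with column y
      ... | ι-col x = scaled-ι x
      ... | z-col   = trans (negated tιe+tz≡0) (cong (t (ι e) *_) (sym τ-z))
      ... | γ-col   = trans (negated tιe+tγ≡0) (cong (t (ι e) *_) (sym τ-γ))

  extend-circuit : ∀ {C c j} → Circuit A C → c ∈Ker A → SupportedIn c C → c j ≢ 0# →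
                   ∀ v g → (∀ x → v x + [ e ↦ g ] x ≡ c x) → v e ≡ 0# ⊎ g ≡ 0# →
                   Circuit B (support (extend v g))
  extend-circuit {C} {c} {j} circuit c∈Ker c⊆C cj≢0 v g v+g≡c ve≡0⊎g≡0 =
    circuit-lift {d = extend v g} {j} circuit (extend∈Ker v g (∈Ker-cong A (λ x → sym (v+g≡c x)) c∈Ker))
      (λ x cdx≢0 → c⊆C x (λ cx≡0 → cdx≢0 (trans (collapse≡c x) cx≡0)))
      (λ cdj≡0 → cj≢0 (trans (sym (collapse≡c j)) cdj≡0))
      (Sum.map (trans (⟦⟧-ι v _ g e)) (trans (⟦⟧-γ v _ g)) ve≡0⊎g≡0)
    where
    collapse≡c : ∀ x → collapse (extend v g) x ≡ c x
    collapse≡c x = trans (collapse-extend v g x) (v+g≡c x)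

  module FromCircuit {C : Subset n} (circuit : Circuit A C) where
    c : Fin n → F
    c = proj₁ (proj₁ circuit)

    c⊆C : SupportedIn c C
    c⊆C = proj₁ (proj₂ (proj₁ circuit))

    c∈Ker : c ∈Ker A
    c∈Ker = proj₂ (proj₂ (proj₂ (proj₁ circuit)))

    c≢0-witness : ∃ λ j → c j ≢ 0#
    c≢0-witness = proj₁ (proj₂ (proj₂ (proj₁ circuit)))

    c≢0 : ∀ u → u ∈ C → c u ≢ 0#
    c≢0 = circuit-vector-nonzero A circuit c∈Ker c⊆C (proj₂ c≢0-witness)

    ĉ : Fin n → F
    ĉ = erase e c

    circuit-on-E : Circuit B (support (extend c 0#))
    circuit-on-E = extend-circuit circuit c∈Ker c⊆C (proj₂ c≢0-witness) c 0#
      (λ x → trans (cong (c x +_) ([↦0#] e x)) (+-identityʳ (c x))) (inj₂ refl)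

    circuit-through-γ : Circuit B (support (extend ĉ (c e)))
    circuit-through-γ = extend-circuit circuit c∈Ker c⊆C (proj₂ c≢0-witness) ĉ (c e)
      (erase+[↦] e c) (inj₁ (erase-same e c))

    ι∈circuit-on-E : ∀ {u} → u ∈ C → ι u ∈ support (extend c 0#)
    ι∈circuit-on-E u∈C = ι∈support-extend 0# (c≢0 _ u∈C)

    ι∈circuit-through-γ : ∀ {u} → u ∈ C → u ≢ e → ι u ∈ support (extend ĉ (c e))
    ι∈circuit-through-γ u∈C u≢e = ι∈support-extend (c e) (λ ĉu≡0 → c≢0 _ u∈C (trans (sym (erase-other c u≢e)) ĉu≡0))

    γ∈circuit-through-γ : e ∈ C → γ ∈ support (extend ĉ (c e))
    γ∈circuit-through-γ e∈C = γ∈support-extend (c≢0 e e∈C)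

    z∈circuit-through-γ : ĉ a + ĉ b ≢ 0# → z ∈ support (extend ĉ (c e))
    z∈circuit-through-γ = z∈support-extend (c e)

    z∈circuit-on-E : e ∈ C → ĉ a + ĉ b ≡ 0# → z ∈ support (extend c 0#)
    z∈circuit-on-E e∈C ĉab≡0 = z∈support-extend 0# λ cab≡0 → c≢0 e e∈C (begin
      c e                                            ≡⟨ sym (+-identityˡ (c e)) ⟩
      0# + c e                                       ≡⟨ cong (_+ c e) (sym ĉab≡0) ⟩
      ĉ a + ĉ b + c e                                ≡⟨ cong (ĉ a + ĉ b +_) (sym ([↦]-same e (c e))) ⟩
      ĉ a + ĉ b + [ e ↦ c e ] e                      ≡⟨ cong (ĉ a + ĉ b +_) (sym (ab-sum [ e ↦ c e ] (λ x → [↦]-other (c e)))) ⟩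
      ĉ a + ĉ b + ([ e ↦ c e ] a + [ e ↦ c e ] b)    ≡⟨ +-interchange (ĉ a) (ĉ b) _ _ ⟩
      (ĉ a + [ e ↦ c e ] a) + (ĉ b + [ e ↦ c e ] b)  ≡⟨ cong₂ _+_ (erase+[↦] e c a) (erase+[↦] e c b) ⟩
      c a + c b                                      ≡⟨ cab≡0 ⟩
      0#                                             ∎)
      where open ≡-Reasoning

  Joined : Fin K → Fin K → Set
  Joined x y = ∃ λ C → Circuit B C × x ∈ C × y ∈ C

  joined-sym : ∀ {x y} → Joined x y → Joined y x
  joined-sym (C , circuit , x∈C , y∈C) = C , circuit , y∈C , x∈C

  module _ (simple : Simple A) (connected : Connected A) where

    triangle-joined : ∀ {x y} → x ∈ support τ → y ∈ support τ → Joined x y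
    triangle-joined x∈ y∈ = support τ , triangle simple , x∈ , y∈

    ιe∈τ : ι e ∈ support τ
    ιe∈τ = ∈support⁺ τ (ι e) (λ τιe≡0 → 1#≢0# p-prime (trans (sym τ-ιe) τιe≡0))

    z∈τ : z ∈ support τ
    z∈τ = ∈support⁺ τ z (λ τz≡0 → -1#≢0# p-prime (trans (sym τ-z) τz≡0))

    γ∈τ : γ ∈ support τ
    γ∈τ = ∈support⁺ τ γ (λ τγ≡0 → -1#≢0# p-prime (trans (sym τ-γ) τγ≡0))

    joined-ι-ι : ∀ u v → u ≢ v → Joined (ι u) (ι v)
    joined-ι-ι u v u≢v with connected u v u≢v
    ... | C , circuit , u∈C , v∈C = _ , circuit-on-E , ι∈circuit-on-E u∈C , ι∈circuit-on-E v∈C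
      where open FromCircuit circuit

    joined-ι-γ : ∀ u → Joined (ι u) γ
    joined-ι-γ = elim-≟ e joined-other (triangle-joined ιe∈τ γ∈τ)
      where
      joined-other : ∀ u → u ≢ e → Joined (ι u) γ
      joined-other u u≢e with connected u e u≢e
      ... | C , circuit , u∈C , e∈C = _ , circuit-through-γ , ι∈circuit-through-γ u∈C u≢e , γ∈circuit-through-γ e∈C
        where open FromCircuit circuit

    joined-ι-z : ∀ u → Joined (ι u) z
    joined-ι-z = elim-≟ e joined-other (triangle-joined ιe∈τ z∈τ)
      where
      joined-other : ∀ u → u ≢ e → Joined (ι u) z
      joined-other u u≢e with connected u e u≢e
      ... | C , circuit , u∈C , e∈C = by-cases (ĉ a + ĉ b ≟ 0#)
        where
        open FromCircuit circuit
        by-cases : Dec (ĉ a + ĉ b ≡ 0#) → Joined (ι u) z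
        by-cases (no ĉab≢0)  = _ , circuit-through-γ , ι∈circuit-through-γ u∈C u≢e , z∈circuit-through-γ ĉab≢0
        by-cases (yes ĉab≡0) = _ , circuit-on-E , ι∈circuit-on-E u∈C , z∈circuit-on-E e∈C ĉab≡0

    connected-B : Connected B
    connected-B x y x≢y with column x | column y
    ... | ι-col u | ι-col v = joined-ι-ι u v (λ u≡v → x≢y (cong ι u≡v))
    ... | ι-col u | z-col   = joined-ι-z u
    ... | ι-col u | γ-col   = joined-ι-γ u
    ... | z-col   | ι-col v = joined-sym (joined-ι-z v)
    ... | z-col   | z-col   = contradiction refl x≢y
    ... | z-col   | γ-col   = triangle-joined z∈τ γ∈τ
    ... | γ-col   | ι-col v = joined-sym (joined-ι-γ v)
    ... | γ-col   | z-col   = triangle-joined γ∈τ z∈τ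
    ... | γ-col   | γ-col   = contradiction refl x≢y

lemma3p2 : (p : ℕ) .{{_ : NonZero p}} → Prime p →
    {m n : ℕ} (A : GF.Mat p m n) →
    GF.Simple p A → GF.Coloopless p A → GF.Connected p A →
    (a b : Fin n) → a ≢ b →
    (α : Fin p) → toℕ α ≢ 0 →
    (e : Fin n) → e ≡ a ⊎ e ≡ b →
    GF.Connected p (GF.Ae p A a b α e)
lemma3p2 p p-prime A simple _ connected a b a≢b α toℕα≢0 e e∈ab =
  Splitting.connected-B p p-prime A a b a≢b α α≢0 e e∈ab simple connected
  where
  α≢0 : α ≢ GF.0F p
  α≢0 α≡0 = toℕα≢0 (trans (cong toℕ α≡0) (GF-Ring.toℕ-0F p))
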